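{- Let $\mathcal{M}$ be an $n$-maniplex and let $\omega\colon E(\mathcal{M})\to\mathbb{Z}_k$ with $k\ge3$ be such that the edge-coloured cross-cover $\mathcal{M}^\omega$ is a maniplex. Suppose $\mathcal{M}$ has a closed walk $W$ of odd length such that $\omega(W)$ is even (i.e. $\omega(W)\equiv 2r\pmod k$ for some integer $r$). Then $\mathcal{M}^\omega$ is not regular.
   Context: An $n$-maniplex is a connected $n$-valent simple graph with a proper edge-colouring by $\{0,\dots,n-1\}$ such that whenever $|i-j|>1$ the subgraph of edges of colours $i,j$ is a disjoint union of $4$-cycles. Automorphisms are edge-colour-preserving graph automorphisms; a maniplex is regular if its automorphism group is transitive on vertices (flags). For $\omega\colon E(\mathcal{M})\to\mathbb{Z}_k$, the cross-cover $\mathcal{M}^\omega$ has vertex set $V(\mathcal{M})\times\mathbb{Z}_k$, with $(u,i)$ adjacent to $(v,\omega(e)-i)$ for each edge $e=uv$ and $i\in\mathbb{Z}_k$, this edge coloured with the colour of $e$. For a walk $W=(u_0,\dots,u_m)$ with edges $e_j=u_ju_{j+1}$, $\omega(W)=\sum_{j=0}^{m-1}(-1)^j\omega(e_j)$. -}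

module Defs where

open import Data.Nat using (ℕ; zero; suc; _∸_; _<_; NonZero) renaming (_+_ to _+ℕ_)
open import Data.Nat.DivMod using (_mod_)
open import Data.Fin using (Fin; toℕ)
open import Data.Integer using (ℤ; +_; _-_; _*_)
open import Data.Integer.Divisibility using (_∣_)
open import Data.List using (List; []; _∷_)
open import Data.Product using (Σ; _×_; _,_; proj₁; proj₂; ∃; ∃-syntax)
open import Data.Sum using (_⊎_)
open import Relation.Binary.PropositionalEquality using (_≡_; _≢_)
open import Function using (_∘_)
open import Function.Bundles using (_↔_; Inverse)

-- An n-edge-coloured graph in which every vertex (flag) has exactly one edge of
-- each colour i ∈ {0,…,n-1}: the colour-i edge at x joins x and r i x
-- (r i is required to be an involution in IsManiplex, making the colour-i edges a
-- perfect matching).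
record Premaniplex (n : ℕ) : Set₁ where
  field
    V      : Set
    r      : Fin n → V → V
open Premaniplex public

module _ {n : ℕ} (M : Premaniplex n) where

  walkEnd : V M → List (Fin n) → V M
  walkEnd x []       = x
  walkEnd x (c ∷ cs) = walkEnd (r M c x) cs

  FarApart : Fin n → Fin n → Set
  FarApart i j = (suc (toℕ i) < toℕ j) ⊎ (suc (toℕ j) < toℕ i)

  -- n-maniplex: connected, simple (no loops, no parallel edges), proper
  -- n-edge-colouring (built in), and for |i-j|>1 the {i,j}-coloured subgraph is a
  -- disjoint union of 4-cycles (x, r_i x, r_j r_i x, r_i r_j r_i x, back to x).
  record IsManiplex : Set where
    field
      r-invol   : ∀ i x → r M i (r M i x) ≡ x
      loopless  : ∀ i x → r M i x ≢ x
      noParallel : ∀ i j x → i ≢ j → r M i x ≢ r M j x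
      connected : ∀ x y → ∃[ cs ] walkEnd x cs ≡ y
      fourCycles : ∀ i j → FarApart i j → ∀ x → r M j (r M i (r M j (r M i x))) ≡ x

  -- automorphism: colour-preserving graph automorphism = bijection on flags
  -- commuting with every r i
  record Automorphism : Set where
    field
      bij : V M ↔ V M
      preserves : ∀ i x → Inverse.to bij (r M i x) ≡ r M i (Inverse.to bij x)

  IsRegular : Set
  IsRegular = ∀ x y → Σ Automorphism λ φ → Inverse.to (Automorphism.bij φ) x ≡ y

  -- ω : E(M) → ℤ_k, given on (vertex, colour) pairs, equal at both endpoints of an edge
  record Voltage (k : ℕ) : Set where
    field
      ω   : V M → Fin n → Fin k
      ω-edge : ∀ i x → ω (r M i x) i ≡ ω x i
  open Voltage public

  -- ω(W) = Σ_j (-1)^j ω(e_j), computed on representatives in ℤ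
  -- (its class mod k is the value in ℤ_k)
  walkValue : ∀ {k} → Voltage k → V M → List (Fin n) → ℤ
  walkValue w x []       = + 0
  walkValue w x (c ∷ cs) = + toℕ (ω w x c) - walkValue w (r M c x) cs

  _⊖_ : ∀ {k} .{{_ : NonZero k}} → Fin k → Fin k → Fin k
  _⊖_ {k} a b = (toℕ a +ℕ (k ∸ toℕ b)) mod k

  crossCover : ∀ {k} .{{_ : NonZero k}} → Voltage k → Premaniplex n
  crossCover {k} w = record
    { V = V M × Fin k
    ; r = λ i p → r M i (proj₁ p) , (ω w (proj₁ p) i ⊖ proj₂ p)
    }

{-# OPTIONS --safe #-}

-- Following a walk W of length ℓ in the cross-cover from (x, a) ends at ℤ_k-coordinate
-- (-1)^ℓ (a - ω(W)). For an odd closed walk W the lift from (x, a) is therefore closed exactly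
-- when 2a ≡ ω(W) (mod k); with ω(W) ≡ 2t this holds for a ≡ t. Automorphisms commute with
-- following walks, so an automorphism sending (x, t) to (x, t + 1), as regularity provides,
-- would close the lift from (x, t + 1) as well, giving 2 ≡ 0 (mod k), impossible for k ≥ 3.

module Submission where

open import Defs
open import Data.Nat using (ℕ; _≤_; NonZero; _+_; _*_)
open import Data.Fin using (Fin)
open import Data.Integer using (ℤ; +_; _-_) renaming (_*_ to _*ℤ_)
open import Data.Integer.Divisibility using (_∣_)
open import Data.List using (List; length)
open import Data.Product using (∃-syntax)
open import Relation.Binary.PropositionalEquality using (_≡_)
open import Relation.Nullary using (¬_)

open import Data.Nat using (_<_; _∸_; >-nonZero⁻¹)
import Data.Nat.Properties as ℕ
import Data.Nat.Divisibility as ℕ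
open import Data.Nat.DivMod using (_%_; _/_; _mod_; m%n<n; m≡m%n+[m/n]*n; m<n⇒m%n≡m)
open import Data.Integer using (-_; -1ℤ; _^_; ∣_∣) renaming (_+_ to _+ℤ_)
import Data.Integer.Properties as ℤ
import Data.Integer.DivMod as ℤ
import Data.Integer.Divisibility.Signed as Signed
open import Data.Integer.Tactic.RingSolver using (solve-∀)
open import Data.Fin using (toℕ; fromℕ<)
open import Data.Fin.Properties using (toℕ-fromℕ<; toℕ<n; toℕ-injective)
open import Data.List using ([]; _∷_)
open import Data.Product using (_,_; proj₁; proj₂)
open import Data.Sum using (inj₁; inj₂)
open import Function.Bundles using (Inverse)
open import Relation.Binary.Bundles using (Setoid)
open import Relation.Binary.Structures using (IsEquivalence)
open import Relation.Binary.PropositionalEquality using (refl; sym; trans; cong; cong₂; subst; module ≡-Reasoning)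
open import Relation.Nullary using (contradiction)
import Relation.Binary.Reasoning.Setoid as SetoidReasoning

module ModularCongruence (k : ℕ) where

  -- A record rather than an abbreviation, so that i and j can be inferred from i ≈ j.
  infix 4 _≈_
  record _≈_ (i j : ℤ) : Set where
    constructor from-∣
    field to-∣ : + k Signed.∣ i - j

  private
    transport : ∀ {d i j} → d ≡ i - j → + k Signed.∣ d → i ≈ j
    transport eq k∣d = from-∣ (subst (+ k Signed.∣_) eq k∣d)

  ≈-reflexive : ∀ {i j} → i ≡ j → i ≈ j
  ≈-reflexive {i} refl = from-∣ (Signed.divides (+ 0) (ℤ.+-inverseʳ i))

  ≈-sym : ∀ {i j} → i ≈ j → j ≈ i
  ≈-sym {i} {j} (from-∣ k∣i-j) = transport (neg-[i-j] i j) (Signed.∣m⇒∣-m k∣i-j)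
    where
    neg-[i-j] : ∀ i j → - (i - j) ≡ j - i
    neg-[i-j] = solve-∀

  ≈-trans : ∀ {i j l} → i ≈ j → j ≈ l → i ≈ l
  ≈-trans {i} {j} {l} (from-∣ k∣i-j) (from-∣ k∣j-l) =
    transport (telescope i j l) (Signed.∣m∣n⇒∣m+n k∣i-j k∣j-l)
    where
    telescope : ∀ i j l → (i - j) +ℤ (j - l) ≡ i - l
    telescope = solve-∀

  ≈-refl : ∀ {i} → i ≈ i
  ≈-refl = ≈-reflexive refl

  ≈-isEquivalence : IsEquivalence _≈_
  ≈-isEquivalence = record { refl = ≈-refl ; sym = ≈-sym ; trans = ≈-trans }

  ≈-setoid : Setoid _ _
  ≈-setoid = record { isEquivalence = ≈-isEquivalence }

  +-cong : ∀ {i j i′ j′} → i ≈ j → i′ ≈ j′ → i +ℤ i′ ≈ j +ℤ j′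
  +-cong {i} {j} {i′} {j′} (from-∣ k∣i-j) (from-∣ k∣i′-j′) =
    transport (interchange i j i′ j′) (Signed.∣m∣n⇒∣m+n k∣i-j k∣i′-j′)
    where
    interchange : ∀ i j i′ j′ → (i - j) +ℤ (i′ - j′) ≡ (i +ℤ i′) - (j +ℤ j′)
    interchange = solve-∀

  neg-cong : ∀ {i j} → i ≈ j → - i ≈ - j
  neg-cong {i} {j} (from-∣ k∣i-j) = transport (neg-[i-j] i j) (Signed.∣m⇒∣-m k∣i-j)
    where
    neg-[i-j] : ∀ i j → - (i - j) ≡ - i - - j
    neg-[i-j] = solve-∀

  -‿cong : ∀ {i j i′ j′} → i ≈ j → i′ ≈ j′ → i - i′ ≈ j - j′
  -‿cong i≈j i′≈j′ = +-cong i≈j (neg-cong i′≈j′)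

  *-congˡ : ∀ c {i j} → i ≈ j → c *ℤ i ≈ c *ℤ j
  *-congˡ c {i} {j} (from-∣ k∣i-j) = transport (distrib c i j) (Signed.∣n⇒∣m*n c k∣i-j)
    where
    distrib : ∀ c i j → c *ℤ (i - j) ≡ c *ℤ i - c *ℤ j
    distrib = solve-∀

  +-multiple≈ : ∀ i q → i +ℤ q *ℤ + k ≈ i
  +-multiple≈ i q = transport (cancel i q (+ k)) (Signed.divides q refl)
    where
    cancel : ∀ i q d → q *ℤ d ≡ (i +ℤ q *ℤ d) - i
    cancel = solve-∀

  module _ .{{_ : NonZero k}} where

    open SetoidReasoning ≈-setoid

    mod-≈ : ∀ m → + toℕ (m mod k) ≈ + m
    mod-≈ m = begin
      + toℕ (m mod k)                 ≡⟨ cong +_ (toℕ-fromℕ< (m%n<n m k)) ⟩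
      + (m % k)                       ≈⟨ ≈-sym (+-multiple≈ (+ (m % k)) (+ (m / k))) ⟩
      + (m % k) +ℤ + (m / k) *ℤ + k   ≡⟨ cong (+ (m % k) +ℤ_) (ℤ.pos-* (m / k) k) ⟨
      + (m % k) +ℤ + (m / k * k)      ≡⟨ ℤ.pos-+ (m % k) (m / k * k) ⟨
      + (m % k + m / k * k)           ≡⟨ cong +_ (m≡m%n+[m/n]*n m k) ⟨
      + m                             ∎

    residue : ℤ → Fin k
    residue i = fromℕ< (ℤ.n%d<d i (+ k))

    residue-≈ : ∀ i → + toℕ (residue i) ≈ i
    residue-≈ i = begin
      + toℕ (residue i)                     ≡⟨ cong +_ (toℕ-fromℕ< (ℤ.n%d<d i (+ k))) ⟩
      + (i ℤ.% + k)                         ≈⟨ ≈-sym (+-multiple≈ (+ (i ℤ.% + k)) (i ℤ./ + k)) ⟩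
      + (i ℤ.% + k) +ℤ (i ℤ./ + k) *ℤ + k   ≡⟨ ℤ.a≡a%n+[a/n]*n i (+ k) ⟨
      i                                     ∎

    ≈⇒≡-≤ : ∀ {a b} → a ≤ b → b < k → + a ≈ + b → a ≡ b
    ≈⇒≡-≤ {a} {b} a≤b b<k (from-∣ k∣a-b) = ℕ.≤-antisym a≤b (ℕ.m∸n≡0⇒m≤n b∸a≡0)
      where
      k∣b∸a : k ℕ.∣ b ∸ a
      k∣b∸a = subst (k ℕ.∣_) (trans (cong ∣_∣ (ℤ.[+m]-[+n]≡m⊖n a b)) (ℤ.∣⊖∣-≤ a≤b))
                    (Signed.∣⇒∣ᵤ k∣a-b)
      b∸a≡0 : b ∸ a ≡ 0
      b∸a≡0 = trans (sym (m<n⇒m%n≡m (ℕ.≤-<-trans (ℕ.m∸n≤m b a) b<k)))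
                    (ℕ.n∣m⇒m%n≡0 (b ∸ a) k k∣b∸a)

    ≈⇒≡ : ∀ {a b} → a < k → b < k → + a ≈ + b → a ≡ b
    ≈⇒≡ {a} {b} a<k b<k a≈b with ℕ.≤-total a b
    ... | inj₁ a≤b = ≈⇒≡-≤ a≤b b<k a≈b
    ... | inj₂ b≤a = sym (≈⇒≡-≤ b≤a a<k (≈-sym a≈b))

-1^odd : ∀ m → -1ℤ ^ (2 * m + 1) ≡ -1ℤ
-1^odd m = begin
  -1ℤ ^ (2 * m + 1)           ≡⟨ ℤ.^-distribˡ-+-* -1ℤ (2 * m) 1 ⟩
  -1ℤ ^ (2 * m) *ℤ -1ℤ ^ 1    ≡⟨ cong (_*ℤ -1ℤ ^ 1) (ℤ.^-*-assoc -1ℤ 2 m) ⟨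
  (-1ℤ ^ 2) ^ m *ℤ -1ℤ ^ 1    ≡⟨ cong (_*ℤ -1ℤ ^ 1) (ℤ.^-zeroˡ m) ⟩
  -1ℤ                         ∎
  where open ≡-Reasoning

module _ {n : ℕ} {M : Premaniplex n} (φ : Automorphism M) where

  open Automorphism φ

  automorphism-walkEnd : ∀ p cs → Inverse.to bij (walkEnd M p cs) ≡ walkEnd M (Inverse.to bij p) cs
  automorphism-walkEnd p []       = refl
  automorphism-walkEnd p (c ∷ cs) =
    trans (automorphism-walkEnd (r M c p) cs) (cong (λ q → walkEnd M q cs) (preserves c p))

  automorphism-closed : ∀ p cs → walkEnd M p cs ≡ p → walkEnd M (Inverse.to bij p) cs ≡ Inverse.to bij p
  automorphism-closed p cs closed =
    trans (sym (automorphism-walkEnd p cs)) (cong (Inverse.to bij) closed)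

module _ {n : ℕ} (M : Premaniplex n) {k : ℕ} .{{_ : NonZero k}} (w : Voltage M k) where

  open ModularCongruence k

  ⊖-≈ : ∀ (a b : Fin k) → + toℕ (_⊖_ M a b) ≈ + toℕ a - + toℕ b
  ⊖-≈ a b = begin
    + toℕ (_⊖_ M a b)                   ≈⟨ mod-≈ (toℕ a + (k ∸ toℕ b)) ⟩
    + (toℕ a + (k ∸ toℕ b))             ≡⟨ ℤ.pos-+ (toℕ a) (k ∸ toℕ b) ⟩
    + toℕ a +ℤ + (k ∸ toℕ b)            ≡⟨ cong (+ toℕ a +ℤ_) k∸b≡k-b ⟩
    + toℕ a +ℤ (+ k - + toℕ b)          ≡⟨ shift (+ toℕ a) (+ toℕ b) (+ k) ⟩
    (+ toℕ a - + toℕ b) +ℤ + 1 *ℤ + k   ≈⟨ +-multiple≈ (+ toℕ a - + toℕ b) (+ 1) ⟩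
    + toℕ a - + toℕ b                   ∎
    where
    open SetoidReasoning ≈-setoid
    k∸b≡k-b : + (k ∸ toℕ b) ≡ + k - + toℕ b
    k∸b≡k-b = sym (trans (ℤ.[+m]-[+n]≡m⊖n k (toℕ b)) (ℤ.⊖-≥ (ℕ.<⇒≤ (toℕ<n b))))
    shift : ∀ a b d → a +ℤ (d - b) ≡ (a - b) +ℤ + 1 *ℤ d
    shift = solve-∀

  crossCover-walkEnd-proj₁ : ∀ x a cs → proj₁ (walkEnd (crossCover M w) (x , a) cs) ≡ walkEnd M x cs
  crossCover-walkEnd-proj₁ x a []       = refl
  crossCover-walkEnd-proj₁ x a (c ∷ cs) = crossCover-walkEnd-proj₁ (r M c x) (_⊖_ M (ω w x c) a) cs

  crossCover-walkEnd-proj₂ : ∀ x a cs → + toℕ (proj₂ (walkEnd (crossCover M w) (x , a) cs))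
                                          ≈ -1ℤ ^ length cs *ℤ (+ toℕ a - walkValue M w x cs)
  crossCover-walkEnd-proj₂ x a []       = ≈-reflexive (sym (trans (ℤ.*-identityˡ _) (ℤ.+-identityʳ _)))
  crossCover-walkEnd-proj₂ x a (c ∷ cs) = begin
    + toℕ (proj₂ (walkEnd (crossCover M w) (r M c x , _⊖_ M o a) cs))
      ≈⟨ crossCover-walkEnd-proj₂ (r M c x) (_⊖_ M o a) cs ⟩
    s *ℤ (+ toℕ (_⊖_ M o a) - W)
      ≈⟨ *-congˡ s (-‿cong (⊖-≈ o a) ≈-refl) ⟩
    s *ℤ ((+ toℕ o - + toℕ a) - W)
      ≡⟨ flip s (+ toℕ a) (+ toℕ o) W ⟩
    -1ℤ *ℤ s *ℤ (+ toℕ a - (+ toℕ o - W)) ∎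
    where
    open SetoidReasoning ≈-setoid
    o = ω w x c
    s = -1ℤ ^ length cs
    W = walkValue M w (r M c x) cs
    flip : ∀ s a o W → s *ℤ ((o - a) - W) ≡ -1ℤ *ℤ s *ℤ (a - (o - W))
    flip = solve-∀

module OddClosedWalk {n : ℕ} (M : Premaniplex n) {k : ℕ} .{{_ : NonZero k}} (w : Voltage M k)
                     (x : V M) (cs : List (Fin n)) (closed : walkEnd M x cs ≡ x)
                     (odd : ∃[ m ] length cs ≡ 2 * m + 1) where

  open ModularCongruence k
  open SetoidReasoning ≈-setoid

  W : ℤ
  W = walkValue M w x cs

  LiftClosed : Fin k → Set
  LiftClosed a = walkEnd (crossCover M w) (x , a) cs ≡ (x , a)

  lift-proj₂ : ∀ a → + toℕ (proj₂ (walkEnd (crossCover M w) (x , a) cs)) ≈ W - + toℕ a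
  lift-proj₂ a = begin
    + toℕ (proj₂ (walkEnd (crossCover M w) (x , a) cs)) ≈⟨ crossCover-walkEnd-proj₂ M w x a cs ⟩
    -1ℤ ^ length cs *ℤ (+ toℕ a - W)                   ≡⟨ cong (λ s → s *ℤ (+ toℕ a - W)) sign ⟩
    -1ℤ *ℤ (+ toℕ a - W)                               ≡⟨ negate (+ toℕ a) W ⟩
    W - + toℕ a                                        ∎
    where
    sign : -1ℤ ^ length cs ≡ -1ℤ
    sign = trans (cong (-1ℤ ^_) (proj₂ odd)) (-1^odd (proj₁ odd))
    negate : ∀ a W → -1ℤ *ℤ (a - W) ≡ W - a
    negate = solve-∀

  liftClosed⇒2a≈W : ∀ {a} → LiftClosed a → + 2 *ℤ + toℕ a ≈ W
  liftClosed⇒2a≈W {a} lift-closed = begin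
    + 2 *ℤ + toℕ a             ≡⟨ double (+ toℕ a) ⟩
    + toℕ a +ℤ + toℕ a         ≈⟨ +-cong a≈W-a ≈-refl ⟩
    (W - + toℕ a) +ℤ + toℕ a   ≡⟨ cancel W (+ toℕ a) ⟩
    W                          ∎
    where
    a≈W-a : + toℕ a ≈ W - + toℕ a
    a≈W-a = subst (λ p → + toℕ (proj₂ p) ≈ W - + toℕ a) lift-closed (lift-proj₂ a)
    double : ∀ a → + 2 *ℤ a ≡ a +ℤ a
    double = solve-∀
    cancel : ∀ W a → (W - a) +ℤ a ≡ W
    cancel = solve-∀

  2a≈W⇒liftClosed : ∀ {a} → + 2 *ℤ + toℕ a ≈ W → LiftClosed a
  2a≈W⇒liftClosed {a} 2a≈W = cong₂ _,_
    (trans (crossCover-walkEnd-proj₁ M w x a cs) closed)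
    (toℕ-injective (≈⇒≡ (toℕ<n _) (toℕ<n a) (begin
      + toℕ (proj₂ (walkEnd (crossCover M w) (x , a) cs))  ≈⟨ lift-proj₂ a ⟩
      W - + toℕ a                                          ≈⟨ -‿cong (≈-sym 2a≈W) ≈-refl ⟩
      + 2 *ℤ + toℕ a - + toℕ a                             ≡⟨ cancel (+ toℕ a) ⟩
      + toℕ a                                              ∎)))
    where
    cancel : ∀ a → + 2 *ℤ a - a ≡ a
    cancel = solve-∀

  consecutive-liftClosed⇒2≈0 : ∀ t → LiftClosed (residue t) → LiftClosed (residue (t +ℤ + 1)) → + 2 ≈ + 0
  consecutive-liftClosed⇒2≈0 t a-closed b-closed = begin
    + 2                                   ≡⟨ difference t ⟩
    + 2 *ℤ (t +ℤ + 1) - + 2 *ℤ t          ≈⟨ -‿cong (*-congˡ (+ 2) (≈-sym (residue-≈ (t +ℤ + 1))))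
                                                     (*-congˡ (+ 2) (≈-sym (residue-≈ t))) ⟩
    + 2 *ℤ + toℕ (residue (t +ℤ + 1))
      - + 2 *ℤ + toℕ (residue t)          ≈⟨ -‿cong (liftClosed⇒2a≈W b-closed) (liftClosed⇒2a≈W a-closed) ⟩
    W - W                                 ≡⟨ ℤ.+-inverseʳ W ⟩
    + 0                                   ∎
    where
    difference : ∀ t → + 2 ≡ + 2 *ℤ (t +ℤ + 1) - + 2 *ℤ t
    difference = solve-∀

lemma3p9 : {n : ℕ} (M : Premaniplex n) → IsManiplex M →
           (k : ℕ) .{{_ : NonZero k}} → 3 ≤ k →
           (w : Voltage M k) → IsManiplex (crossCover M w) →
           (x : V M) (cs : List (Fin n)) → walkEnd M x cs ≡ x →
           (∃[ m ] length cs ≡ 2 * m + 1) →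
           (∃[ t ] (+ k) ∣ (walkValue M w x cs - (+ 2) *ℤ t)) →
           ¬ IsRegular (crossCover M w)
lemma3p9 M _ k 3≤k w _ x cs closed odd (t , k∣W-2t) regular =
  contradiction (≈⇒≡ 3≤k (>-nonZero⁻¹ k) (consecutive-liftClosed⇒2≈0 t a-closed b-closed)) λ ()
  where
  open ModularCongruence k
  open OddClosedWalk M w x cs closed odd
  a b : Fin k
  a = residue t
  b = residue (t +ℤ + 1)
  2a≈W : + 2 *ℤ + toℕ a ≈ W
  2a≈W = ≈-trans (*-congˡ (+ 2) (residue-≈ t)) (≈-sym (from-∣ (Signed.∣ᵤ⇒∣ k∣W-2t)))
  a-closed : LiftClosed a
  a-closed = 2a≈W⇒liftClosed 2a≈W
  b-closed : LiftClosed b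
  b-closed with regular (x , a) (x , b)
  ... | φ , φ[x,a]≡[x,b] = subst (λ p → walkEnd (crossCover M w) p cs ≡ p) φ[x,a]≡[x,b]
                                 (automorphism-closed φ (x , a) cs a-closed)
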